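{- Let $w$ be a string and $c$ a positive integer. Suppose $a$ and $b$ are maximally periodic substrings (with parameter $c$) of $w$. If $a\ne b$ (as substrings, i.e., occupying different position ranges), then $a$ and $b$ overlap in fewer than $2c$ letters.
   Context: A string $u$ is $p$-periodic if $u_i=u_{i+p}$ for all $1\le i\le|u|-p$; its minimum period is the least such $p\ge1$. A contiguous substring $a$ of $w$ is a maximally periodic substring with parameter $c$ if $|a|\ge8c$, $a$ has minimum period at most $c$, and extending $a$ by one letter of $w$ on either the left or the right yields a string whose minimum period is greater than $c$. -}

module Defs where

open import Data.Nat using (ℕ; zero; suc; _+_; _*_; _∸_; _≤_; _<_; _⊔_; _⊓_)
open import Data.List using (List; length; take; drop; lookup)
open import Data.Fin using (fromℕ<)
open import Data.Product using (_×_; Σ; ∃-syntax)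
open import Relation.Binary.PropositionalEquality using (_≡_)

-- Strings are lists over an arbitrary alphabet A; positions are 0-indexed.

Periodic : {A : Set} → ℕ → List A → Set
Periodic p u = ∀ k → (h₁ : k < length u) → (h₂ : k + p < length u) →
  lookup u (fromℕ< h₁) ≡ lookup u (fromℕ< h₂)

MinPeriod : {A : Set} → List A → ℕ → Set
MinPeriod u p = (1 ≤ p) × Periodic p u × (∀ q → 1 ≤ q → Periodic q u → p ≤ q)

substr : {A : Set} → List A → ℕ → ℕ → List A
substr w i j = take (j ∸ i) (drop i w)

-- the substring w[i..j) (with i ≤ j ≤ |w|) is a maximally periodic substring
-- with parameter c. Extension on a side is required only when that letter
-- exists in w.
MaxPeriodic : {A : Set} → ℕ → List A → ℕ → ℕ → Set
MaxPeriodic c w i j =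
  (i ≤ j) × (j ≤ length w) × (8 * c ≤ j ∸ i)
  × (∃[ p ] (MinPeriod (substr w i j) p × p ≤ c))
  × (∀ i' → suc i' ≡ i → ∀ p → MinPeriod (substr w i' j) p → c < p)
  × (j < length w → ∀ p → MinPeriod (substr w i (suc j)) p → c < p)

overlapLen : ℕ → ℕ → ℕ → ℕ → ℕ
overlapLen i j i' j' = (j ⊓ j') ∸ (i ⊔ i')

-- Let a = w[i..j) and b = w[i'..j') be maximal with periods p, q ≤ c,
-- and suppose their overlap has at least 2c ≥ p + q letters.  If a starts
-- strictly after b (i' < i), then the letter w[i-1] lies in b, and the chain
--   w[i-1] = w[i-1+q] = w[i-1+q+p] = w[i-1+p+q] = w[i-1+p]
-- (periods q, p, then q backwards, all inside the overlap) shows that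
-- w[i-1..j) is still p-periodic.  Then w[i-1..j) has a minimum period ≤ p ≤ c,
-- contradicting maximality of a.  Symmetrically, if a ends strictly before b
-- (j < j'), the letter w[j] lies in b and w[i..j+1) is still p-periodic.
-- Since a ≠ b, one of these two situations occurs after possibly swapping a, b.

module Submission where

open import Defs
open import Data.Nat using (ℕ; zero; suc; _+_; _*_; _∸_; _<_; _≤_; s≤s; _⊓_; _⊔_)
open import Data.Nat.Properties
open import Data.Nat.Induction using (<-rec)
open import Data.List using (List; []; _∷_; length; take; drop; lookup)
open import Data.List.Properties using (length-take; length-drop)
open import Data.Maybe using (Maybe; just; nothing)
open import Data.Maybe.Properties using (just-injective)
open import Data.Fin using (fromℕ<)
open import Data.Product using (_×_; _,_; ∃-syntax)
open import Data.Sum using (inj₁; inj₂)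
open import Data.Empty using (⊥)
open import Function.Bundles using (_⇔_; mk⇔; Equivalence)
open import Relation.Binary.PropositionalEquality
open import Relation.Binary.Definitions using (tri<; tri≈; tri>)
open import Relation.Nullary using (¬_)
open import Algebra.Properties.CommutativeSemigroup +-commutativeSemigroup
  using (xy∙z≈xz∙y)

PeriodicOn : {B : Set} → (ℕ → B) → ℕ → ℕ → ℕ → Set
PeriodicOn f i j p = ∀ x → i ≤ x → x + p < j → f x ≡ f (x + p)

-- Total indexing of lists, so that a string becomes a sequence ℕ → Maybe A.
module Indexing {A : Set} where

  at : List A → ℕ → Maybe A
  at []       _       = nothing
  at (x ∷ xs) zero    = just x
  at (x ∷ xs) (suc k) = at xs k

  at-lookup : ∀ (xs : List A) k (k<n : k < length xs) →
              at xs k ≡ just (lookup xs (fromℕ< k<n))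
  at-lookup (x ∷ xs) zero    _         = refl
  at-lookup (x ∷ xs) (suc k) (s≤s k<n) = at-lookup xs k k<n

  at-drop : ∀ i (xs : List A) k → at (drop i xs) k ≡ at xs (i + k)
  at-drop zero    xs       k = refl
  at-drop (suc i) []       k = refl
  at-drop (suc i) (x ∷ xs) k = at-drop i xs k

  at-take : ∀ m (xs : List A) k → k < m → at (take m xs) k ≡ at xs k
  at-take (suc m) []       k       _         = refl
  at-take (suc m) (x ∷ xs) zero    _         = refl
  at-take (suc m) (x ∷ xs) (suc k) (s≤s k<m) = at-take m xs k k<m

  at-substr : ∀ (w : List A) i j k → k < j ∸ i → at (substr w i j) k ≡ at w (i + k)
  at-substr w i j k k< = trans (at-take (j ∸ i) (drop i w) k k<) (at-drop i w k)

  length-substr : ∀ (w : List A) i j → j ≤ length w → length (substr w i j) ≡ j ∸ i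
  length-substr w i j j≤ = begin
    length (take (j ∸ i) (drop i w)) ≡⟨ length-take (j ∸ i) (drop i w) ⟩
    (j ∸ i) ⊓ length (drop i w)      ≡⟨ cong ((j ∸ i) ⊓_) (length-drop i w) ⟩
    (j ∸ i) ⊓ (length w ∸ i)         ≡⟨ m≤n⇒m⊓n≡m (∸-monoˡ-≤ i j≤) ⟩
    j ∸ i                            ∎
    where open ≡-Reasoning

  periodicOn-substr : ∀ (w : List A) i j p → j ≤ length w →
                      Periodic p (substr w i j) → PeriodicOn (at w) i j p
  periodicOn-substr w i j p j≤ per x i≤x x+p<j = begin
    at w x                         ≡⟨ cong (at w) (sym (m+[n∸m]≡n i≤x)) ⟩
    at w (i + k)                   ≡⟨ sym (at-substr w i j k k<) ⟩
    at u k                         ≡⟨ at-lookup u k k<u ⟩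
    just (lookup u (fromℕ< k<u))   ≡⟨ cong just (per k k<u k+p<u) ⟩
    just (lookup u (fromℕ< k+p<u)) ≡⟨ sym (at-lookup u (k + p) k+p<u) ⟩
    at u (k + p)                   ≡⟨ at-substr w i j (k + p) k+p< ⟩
    at w (i + (k + p))             ≡⟨ cong (at w) (sym (+-assoc i k p)) ⟩
    at w (i + k + p)               ≡⟨ cong (λ y → at w (y + p)) (m+[n∸m]≡n i≤x) ⟩
    at w (x + p)                   ∎
    where
    open ≡-Reasoning
    u = substr w i j
    k = x ∸ i
    k+p< : k + p < j ∸ i
    k+p< = subst (_< j ∸ i) (+-∸-comm p i≤x) (∸-monoˡ-< x+p<j (≤-trans i≤x (m≤m+n x p)))
    k< : k < j ∸ i
    k< = ≤-<-trans (m≤m+n k p) k+p<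
    k+p<u : k + p < length u
    k+p<u = subst (k + p <_) (sym (length-substr w i j j≤)) k+p<
    k<u : k < length u
    k<u = ≤-<-trans (m≤m+n k p) k+p<u

  substr-periodicOn : ∀ (w : List A) i j p → j ≤ length w → i ≤ j →
                      PeriodicOn (at w) i j p → Periodic p (substr w i j)
  substr-periodicOn w i j p j≤ i≤j per k k<u k+p<u = just-injective (begin
    just (lookup u (fromℕ< k<u))   ≡⟨ sym (at-lookup u k k<u) ⟩
    at u k                         ≡⟨ at-substr w i j k k< ⟩
    at w (i + k)                   ≡⟨ per (i + k) (m≤m+n i k) i+k+p<j ⟩
    at w (i + k + p)               ≡⟨ cong (at w) (+-assoc i k p) ⟩
    at w (i + (k + p))             ≡⟨ sym (at-substr w i j (k + p) k+p<) ⟩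
    at u (k + p)                   ≡⟨ at-lookup u (k + p) k+p<u ⟩
    just (lookup u (fromℕ< k+p<u)) ∎)
    where
    open ≡-Reasoning
    u = substr w i j
    k+p< : k + p < j ∸ i
    k+p< = subst (k + p <_) (length-substr w i j j≤) k+p<u
    k< : k < j ∸ i
    k< = ≤-<-trans (m≤m+n k p) k+p<
    i+k+p<j : i + k + p < j
    i+k+p<j = subst (_< j) (sym (+-assoc i k p))
                (subst (i + (k + p) <_) (m+[n∸m]≡n i≤j) (+-monoʳ-< i k+p<))

open Indexing

min-period-below : {A : Set} (u : List A) → ∀ p → 1 ≤ p → Periodic p u →
                   ¬ ¬ (∃[ q ] (MinPeriod u q × q ≤ p))
min-period-below u = <-rec Goal step
  where
  Goal : ℕ → Set
  Goal p = 1 ≤ p → Periodic p u → ¬ ¬ (∃[ q ] (MinPeriod u q × q ≤ p))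
  step : ∀ p → (∀ {r} → r < p → Goal r) → Goal p
  step p smaller 1≤p per none = none (p , (1≤p , per , minimal) , ≤-refl)
    where
    minimal : ∀ q → 1 ≤ q → Periodic q u → p ≤ q
    minimal q 1≤q perq = ≮⇒≥ λ q<p →
      smaller q<p 1≤q perq λ (r , minr , r≤q) → none (r , minr , ≤-trans r≤q (<⇒≤ q<p))

transfer-period : {B : Set} (f : ℕ → B) {z p q : ℕ} →
                  f z ≡ f (z + q) → f (z + p) ≡ f (z + p + q) →
                  (f z ≡ f (z + p)) ⇔ (f (z + q) ≡ f (z + q + p))
transfer-period f {z} {p} {q} qz qzp = mk⇔ forward backward
  where
  swap : f (z + q + p) ≡ f (z + p + q)
  swap = cong f (xy∙z≈xz∙y z q p)
  forward : f z ≡ f (z + p) → f (z + q) ≡ f (z + q + p)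
  forward pz = trans (sym qz) (trans pz (trans qzp (sym swap)))
  backward : f (z + q) ≡ f (z + q + p) → f z ≡ f (z + p)
  backward pzq = trans qz (trans pzq (trans swap (sym qzp)))

extend-left : {B : Set} (f : ℕ → B) {s j i' j' p q : ℕ} →
              PeriodicOn f (suc s) j p → PeriodicOn f i' j' q → 1 ≤ q → i' ≤ s →
              s + (p + q) < j ⊓ j' → PeriodicOn f s j p
extend-left f {s} {j} {i'} {j'} {p} {q} perA perB 1≤q i'≤s bound x s≤x x+p<j
  with m≤n⇒m<n∨m≡n s≤x
... | inj₁ s<x  = perA x s<x x+p<j
... | inj₂ refl =
  Equivalence.from (transfer-period f (perB s i'≤s s+q<j') (perB (s + p) s+p≥i' s+p+q<j'))
                   (perA (s + q) (m<m+n s 1≤q) s+q+p<j)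
  where
  s+p+q<j : s + p + q < j
  s+p+q<j = subst (_< j) (sym (+-assoc s p q)) (<-≤-trans bound (m⊓n≤m j j'))
  s+p+q<j' : s + p + q < j'
  s+p+q<j' = subst (_< j') (sym (+-assoc s p q)) (<-≤-trans bound (m⊓n≤n j j'))
  s+q+p<j : s + q + p < j
  s+q+p<j = subst (_< j) (sym (xy∙z≈xz∙y s q p)) s+p+q<j
  s+q<j' : s + q < j'
  s+q<j' = ≤-<-trans (m≤m+n (s + q) p) (subst (_< j') (sym (xy∙z≈xz∙y s q p)) s+p+q<j')
  s+p≥i' : i' ≤ s + p
  s+p≥i' = ≤-trans i'≤s (m≤m+n s p)

extend-right : {B : Set} (f : ℕ → B) {i j i' j' p q : ℕ} →
               PeriodicOn f i j p → PeriodicOn f i' j' q → 1 ≤ q → j < j' →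
               (i ⊔ i') + (p + q) ≤ j → PeriodicOn f i (suc j) p
extend-right f {i} {j} {i'} {j'} {p} {q} perA perB 1≤q j<j' bound x i≤x x+p<1+j
  with m≤n⇒m<n∨m≡n (≤-pred x+p<1+j)
... | inj₁ x+p<j  = perA x i≤x x+p<j
... | inj₂ x+p≡j  = subst (λ y → f y ≡ f (y + p)) (m∸n+n≡m q≤x)
  (Equivalence.to (transfer-period f (perB z i'≤z z+q<j') (perB (z + p) i'≤z+p z+p+q<j'))
                  (perA z i≤z z+p<j))
  where
  z = x ∸ q
  ⊔+p+q≤x+p : (i ⊔ i') + (p + q) ≤ x + p
  ⊔+p+q≤x+p = subst ((i ⊔ i') + (p + q) ≤_) (sym x+p≡j) bound
  q≤x : q ≤ x
  q≤x = +-cancelʳ-≤ p q x (≤-trans (subst (_≤ (i ⊔ i') + (p + q)) (+-comm p q)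
                                         (m≤n+m (p + q) (i ⊔ i'))) ⊔+p+q≤x+p)
  z+q+p≡j : z + q + p ≡ j
  z+q+p≡j = trans (cong (_+ p) (m∸n+n≡m q≤x)) x+p≡j
  z+p+q≡j : z + p + q ≡ j
  z+p+q≡j = trans (sym (xy∙z≈xz∙y z q p)) z+q+p≡j
  -- both ranges start at or before z, because z + (p + q) = j
  ⊔≤z : i ⊔ i' ≤ z
  ⊔≤z = +-cancelʳ-≤ (p + q) (i ⊔ i') z
          (subst ((i ⊔ i') + (p + q) ≤_) (sym (trans (sym (+-assoc z p q)) z+p+q≡j)) bound)
  i≤z : i ≤ z
  i≤z = ≤-trans (m≤m⊔n i i') ⊔≤z
  i'≤z : i' ≤ z
  i'≤z = ≤-trans (m≤n⊔m i i') ⊔≤z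
  i'≤z+p : i' ≤ z + p
  i'≤z+p = ≤-trans i'≤z (m≤m+n z p)
  z+p<j : z + p < j
  z+p<j = subst (z + p <_) z+p+q≡j (m<m+n (z + p) 1≤q)
  z+q<j' : z + q < j'
  z+q<j' = ≤-<-trans (subst (z + q ≤_) z+q+p≡j (m≤m+n (z + q) p)) j<j'
  z+p+q<j' : z + p + q < j'
  z+p+q<j' = subst (_< j') (sym z+p+q≡j) j<j'

module _ {A : Set} (w : List A) (c : ℕ) where

  period-of : ∀ {i j} → MaxPeriodic c w i j →
              ∃[ p ] (1 ≤ p × p ≤ c × PeriodicOn (at w) i j p)
  period-of (_ , j≤ , _ , (p , (1≤p , per , _) , p≤c) , _) =
    p , 1≤p , p≤c , periodicOn-substr w _ _ p j≤ per

  periodic-extension-impossible : ∀ i j p → 1 ≤ p → p ≤ c →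
    Periodic p (substr w i j) → (∀ q → MinPeriod (substr w i j) q → c < q) → ⊥
  periodic-extension-impossible i j p 1≤p p≤c per maximal =
    min-period-below (substr w i j) p 1≤p per
      λ (q , minq , q≤p) → <⇒≱ (maximal q minq) (≤-trans q≤p p≤c)

  not-extendable-left : ∀ {s j} → MaxPeriodic c w (suc s) j → ∀ p → 1 ≤ p → p ≤ c →
                        ¬ PeriodicOn (at w) s j p
  not-extendable-left {s} {j} (s<j , j≤ , _ , _ , left-max , _) p 1≤p p≤c per =
    periodic-extension-impossible s j p 1≤p p≤c
      (substr-periodicOn w s j p j≤ (≤-trans (n≤1+n s) s<j) per) (left-max s refl)

  not-extendable-right : ∀ {i j} → MaxPeriodic c w i j → j < length w →
                         ∀ p → 1 ≤ p → p ≤ c → ¬ PeriodicOn (at w) i (suc j) p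
  not-extendable-right {i} {j} (i≤j , _ , _ , _ , _ , right-max) j<n p 1≤p p≤c per =
    periodic-extension-impossible i (suc j) p 1≤p p≤c
      (substr-periodicOn w i (suc j) p j<n (≤-trans i≤j (n≤1+n j)) per) (right-max j<n)

periods-fit : ∀ {c p q} → p ≤ c → q ≤ c → p + q ≤ 2 * c
periods-fit {c} p≤c q≤c = +-mono-≤ p≤c (subst (_ ≤_) (sym (+-identityʳ c)) q≤c)

fits-in-range : ∀ {a b n} → 1 ≤ n → n ≤ b ∸ a → a + n ≤ b
fits-in-range {a} {b} {n} 1≤n n≤b∸a = subst (_≤ b) (+-comm n a) (m≤o∸n⇒m+n≤o n a≤b n≤b∸a)
  where
  a≤b : a ≤ b
  a≤b = <⇒≤ (m∸n≢0⇒n<m λ b∸a≡0 → <⇒≱ 1≤n (subst (n ≤_) b∸a≡0 n≤b∸a))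

module _ {A : Set} (w : List A) (c : ℕ) (1≤c : 1 ≤ c) where

  1≤2c : 1 ≤ 2 * c
  1≤2c = ≤-trans 1≤c (m≤m+n c _)

  overlap-short-left : ∀ {i j i' j'} → MaxPeriodic c w i j → MaxPeriodic c w i' j' →
                       i' < i → ¬ (2 * c ≤ overlapLen i j i' j')
  overlap-short-left {suc s} {j} {i'} {j'} maxA maxB (s≤s i'≤s) long
    with period-of w c maxA | period-of w c maxB
  ... | p , 1≤p , p≤c , perA | q , 1≤q , q≤c , perB =
    not-extendable-left w c maxA p 1≤p p≤c
      (extend-left (at w) perA perB 1≤q i'≤s (≤-trans (+-monoʳ-≤ (suc s) (periods-fit p≤c q≤c)) s+2c≤))
    where
    s+2c≤ : suc s + 2 * c ≤ j ⊓ j'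
    s+2c≤ = fits-in-range 1≤2c (subst (λ t → 2 * c ≤ (j ⊓ j') ∸ t)
                                      (m≥n⇒m⊔n≡m (≤-trans i'≤s (n≤1+n s))) long)

  overlap-short-right : ∀ {i j i' j'} → MaxPeriodic c w i j → MaxPeriodic c w i' j' →
                        j < j' → ¬ (2 * c ≤ overlapLen i j i' j')
  overlap-short-right {i} {j} {i'} {j'} maxA maxB@(_ , j'≤n , _) j<j' long
    with period-of w c maxA | period-of w c maxB
  ... | p , 1≤p , p≤c , perA | q , 1≤q , q≤c , perB =
    not-extendable-right w c maxA (<-≤-trans j<j' j'≤n) p 1≤p p≤c
      (extend-right (at w) perA perB 1≤q j<j' (≤-trans (+-monoʳ-≤ (i ⊔ i') (periods-fit p≤c q≤c)) ⊔+2c≤j))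
    where
    ⊔+2c≤j : (i ⊔ i') + 2 * c ≤ j
    ⊔+2c≤j = fits-in-range {i ⊔ i'} 1≤2c (subst (λ t → 2 * c ≤ t ∸ (i ⊔ i')) (m≤n⇒m⊓n≡m (<⇒≤ j<j')) long)

overlapLen-comm : ∀ i j i' j' → overlapLen i j i' j' ≡ overlapLen i' j' i j
overlapLen-comm i j i' j' = cong₂ _∸_ (⊓-comm j j') (⊔-comm i i')

lemma45 : {A : Set} (w : List A) (c : ℕ) → 1 ≤ c →
          (i j i' j' : ℕ) →
          MaxPeriodic c w i j → MaxPeriodic c w i' j' →
          ¬ ((i ≡ i') × (j ≡ j')) →
          overlapLen i j i' j' < 2 * c
lemma45 w c 1≤c i j i' j' maxA maxB distinct = ≰⇒> short
  where
  swapped : ¬ (2 * c ≤ overlapLen i' j' i j) → ¬ (2 * c ≤ overlapLen i j i' j')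
  swapped short' long = short' (subst (2 * c ≤_) (overlapLen-comm i j i' j') long)
  short : ¬ (2 * c ≤ overlapLen i j i' j')
  short with <-cmp i' i | <-cmp j j'
  ... | tri< i'<i _ _ | _             = overlap-short-left w c 1≤c maxA maxB i'<i
  ... | tri> _ _ i<i' | _             = swapped (overlap-short-left w c 1≤c maxB maxA i<i')
  ... | tri≈ _ _ _    | tri< j<j' _ _ = overlap-short-right w c 1≤c maxA maxB j<j'
  ... | tri≈ _ _ _    | tri> _ _ j'<j = swapped (overlap-short-right w c 1≤c maxB maxA j'<j)
  ... | tri≈ _ i'≡i _ | tri≈ _ j≡j' _ = λ _ → distinct (sym i'≡i , j≡j')
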